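{- Let $f(p)$ denote the length of the shortest binary overlap-free word having exactly $p$ nontrivial periods. Then $f(1)=2$, $f(2)=5$, and $f(p) \leq \frac{17}{6}4^{p-2} + \frac23$ for all $p\ge3$.
   Context: An overlap is a word of the form $axaxa$ with $a$ a single letter and $x$ a possibly empty word; a word is overlap-free if none of its factors is an overlap. For a finite nonempty word $w$, an integer $p$ with $1\le p\le|w|$ is a period if $w[i]=w[i+p]$ for $1\le i\le |w|-p$; it is nontrivial if $p<|w|$. -}

module Defs where

open import Data.Bool using (Bool)
open import Data.Nat using (ℕ; zero; suc; _+_; _*_; _≤_; _<_)
open import Data.List using (List; []; _∷_; _++_; [_]; length)
open import Data.Maybe using (Maybe; nothing; just)
open import Data.Product using (Σ; _×_; ∃-syntax)
open import Data.List.Membership.Propositional using (_∈_)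
open import Data.List.Relation.Unary.Unique.Propositional using (Unique)
open import Function.Bundles using (_⇔_)
open import Relation.Nullary using (¬_)
open import Relation.Binary.PropositionalEquality using (_≡_)

Word : Set
Word = List Bool

-- 0-based letter access (nothing when out of range).
_‼_ : {A : Set} → List A → ℕ → Maybe A
[]       ‼ _     = nothing
(x ∷ xs) ‼ zero  = just x
(x ∷ xs) ‼ suc i = xs ‼ i

IsOverlap : Word → Set
IsOverlap v = ∃[ a ] ∃[ x ] (v ≡ a ∷ x ++ a ∷ x ++ [ a ])

OverlapFree : Word → Set
OverlapFree w = ¬ (∃[ u ] ∃[ v ] ∃[ t ] (w ≡ u ++ v ++ t × IsOverlap v))

IsPeriod : Word → ℕ → Set
IsPeriod w p = 1 ≤ p × p ≤ length w × (∀ i → i + p < length w → w ‼ i ≡ w ‼ (i + p))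

IsNontrivialPeriod : Word → ℕ → Set
IsNontrivialPeriod w p = IsPeriod w p × p < length w

HasExactlyNontrivialPeriods : Word → ℕ → Set
HasExactlyNontrivialPeriods w k =
  ∃[ ps ] (Unique ps × (∀ q → (q ∈ ps) ⇔ IsNontrivialPeriod w q) × length ps ≡ k)

Good : ℕ → Word → Set
Good p w = OverlapFree w × HasExactlyNontrivialPeriods w p

fIs : ℕ → ℕ → Set
fIs p n = (∃[ w ] (Good p w × length w ≡ n)) × (∀ w → Good p w → n ≤ length w)

module Submission where

-- We first relate the
-- factor definition of overlap-freeness to an index form (no window of length 2p + 1
-- has period p), which makes small cases decidable, so that f(1) = 2 and f(2) = 5 are
-- settled by computation: the words 00 and 00100, and an exhaustive check of all
-- words of length at most 4.
--
-- Starting from 001001100100,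
-- which has the nontrivial periods 9, 10, 11, the step x ↦ next x = μ²(x) with first
-- and last letter removed (μ the Thue–Morse morphism) preserves overlap-freeness
-- (Thue's theorem for μ), sends |x| to 4|x| - 2, and maps the nontrivial periods of x
-- bijectively onto those of next x other than |next x| - 1, by p ↦ 4p.  The converse
-- direction is the heart of the argument: a period of next x far from its length
-- desubstitutes twice through μ, since μ z with z overlap-free has no odd period on a
-- window of length q + 4.  Hence stage k has exactly k + 3 nontrivial periods and
-- length (17·4^(k+1) + 4)/6, which is the bound of the corollary.

open import Defs
open import Data.Bool using (Bool; true; false; not)
open import Data.Bool.Properties using (not-involutive) renaming (_≟_ to _≟ᵇ_)
open import Data.Empty using (⊥; ⊥-elim)
open import Data.List using (List; []; _∷_; _++_; [_]; length; take; drop; map; filter; upTo)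
open import Data.List.Membership.Propositional using (_∈_)
open import Data.List.Membership.Propositional.Properties using (∈-++⁺ˡ; ∈-++⁺ʳ; ∈-filter⁺; ∈-filter⁻; ∈-upTo⁺; ∈-map⁺; ∈-map⁻)
open import Data.List.Relation.Unary.All using (All)
import Data.List.Relation.Unary.All as All
open import Data.List.Relation.Unary.Any using (here; there)
open import Data.List.Relation.Unary.AllPairs using (_∷_)
import Data.List.Relation.Unary.Unique.Propositional.Properties as Unique
open import Data.List.Properties using (++-assoc; length-map; length-++; length-take; length-drop; take++drop≡id)
open import Data.Maybe using (Maybe; just; nothing)
import Data.Maybe as Maybe
open import Data.Maybe.Properties using (≡-dec; just-injective)
open import Data.Nat using (ℕ; zero; suc; _+_; _*_; _^_; _∸_; _⊓_; _≤_; _<_; _≤?_; _<?_; z≤n; s≤s)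
open import Data.Nat.Properties
open import Data.Nat.Tactic.RingSolver using (solve)
open import Data.Product using (_×_; _,_; ∃-syntax; proj₁; proj₂)
open import Data.Sum using (_⊎_; inj₁; inj₂)
open import Function using (_∘_)
open import Function.Bundles using (_⇔_; mk⇔; Equivalence)
open import Relation.Nullary using (¬_; Dec; yes; no)
open import Relation.Nullary.Decidable using (map′; _→-dec_; _×-dec_; _⊎-dec_; ¬?; from-yes)
open import Relation.Binary.PropositionalEquality hiding ([_])

‼-defined : ∀ (w : Word) {i} → i < length w → ∃[ a ] (w ‼ i ≡ just a)
‼-defined (a ∷ w) {zero}  _         = a , refl
‼-defined (_ ∷ w) {suc i} (s≤s i<n) = ‼-defined w i<n

++-‼ˡ : ∀ (u v : Word) {i} → i < length u → (u ++ v) ‼ i ≡ u ‼ i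
++-‼ˡ (a ∷ u) v {zero}  _         = refl
++-‼ˡ (a ∷ u) v {suc i} (s≤s i<n) = ++-‼ˡ u v i<n

++-‼ʳ : ∀ (u v : Word) k → (u ++ v) ‼ (length u + k) ≡ v ‼ k
++-‼ʳ []      v k = refl
++-‼ʳ (_ ∷ u) v k = ++-‼ʳ u v k

++-‼-past : ∀ (s t : Word) {p} → length s ≡ p → ∀ j → (s ++ t) ‼ (p + j) ≡ t ‼ j
++-‼-past s t refl = ++-‼ʳ s t

take-‼ : ∀ n (w : Word) {i} → i < n → take n w ‼ i ≡ w ‼ i
take-‼ (suc n) []      _         = refl
take-‼ (suc n) (a ∷ w) {zero}  _         = refl
take-‼ (suc n) (a ∷ w) {suc i} (s≤s i<n) = take-‼ n w i<n

drop-‼ : ∀ n (w : Word) i → drop n w ‼ i ≡ w ‼ (n + i)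
drop-‼ zero    w       i = refl
drop-‼ (suc n) []      i = refl
drop-‼ (suc n) (_ ∷ w) i = drop-‼ n w i

‼-ext : ∀ (u v : Word) → length u ≡ length v → (∀ i → i < length u → u ‼ i ≡ v ‼ i) → u ≡ v
‼-ext []      []      _  _ = refl
‼-ext (a ∷ u) (b ∷ v) ℓ≡ h =
  cong₂ _∷_ (just-injective (h 0 (s≤s z≤n))) (‼-ext u v (suc-injective ℓ≡) (λ i i<n → h (suc i) (s≤s i<n)))

-- Letters at equal positions agree (positions explicit, so that the equation can be solved).
‼-cong : ∀ (w : Word) i j → i ≡ j → w ‼ i ≡ w ‼ j
‼-cong w i j = cong (w ‼_)

relabel : ∀ (w : Word) {i i' j j'} → i ≡ i' → j ≡ j' → w ‼ i ≡ w ‼ j → w ‼ i' ≡ w ‼ j'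
relabel w refl refl e = e

≤-by : ∀ {a b} d → a + d ≡ b → a ≤ b
≤-by {a} d refl = m≤m+n a d

-- Restate the lower end of an inequality (the equation is solved once both ends are known).
≤-relabelˡ : ∀ {a b c} → a ≤ b → c ≡ a → c ≤ b
≤-relabelˡ a≤b refl = a≤b

data Parity : ℕ → Set where
  even : ∀ t → Parity (2 * t)
  odd  : ∀ t → Parity (suc (2 * t))

parity : ∀ n → Parity n
parity zero = even 0
parity (suc n) with parity n
... | even t = odd t
... | odd t  = subst Parity (*-suc 2 t) (even (suc t))

PeriodicOn : Word → ℕ → ℕ → ℕ → Set
PeriodicOn w p lo hi = ∀ k → lo ≤ k → k + p < hi → w ‼ k ≡ w ‼ (k + p)

Periodic : Word → ℕ → Set
Periodic w p = ∀ i → i + p < length w → w ‼ i ≡ w ‼ (i + p)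

periodicOn-⊆ : ∀ w {p lo hi} lo' hi' → PeriodicOn w p lo hi → lo ≤ lo' → hi' ≤ hi → PeriodicOn w p lo' hi'
periodicOn-⊆ w lo' hi' periodic lo≤lo' hi'≤hi k lo'≤k k+p<hi' = periodic k (≤-trans lo≤lo' lo'≤k) (<-≤-trans k+p<hi' hi'≤hi)

OverlapFreeIx : Word → Set
OverlapFreeIx w = ∀ i p → 1 ≤ p → i + suc (p + p) ≤ length w → ¬ PeriodicOn w p i (i + suc (p + p))

-- The overlap a x a x a of length 2p + 1 has period p = |a x|.
overlap⇒periodic : ∀ {v} → IsOverlap v → ∃[ p ] (1 ≤ p × length v ≡ suc (p + p) × Periodic v p)
overlap⇒periodic (a , x , refl) = p , s≤s z≤n , |v| , period
  where
    s = a ∷ x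
    p = length s
    |s++[a]| : length (s ++ [ a ]) ≡ suc p
    |s++[a]| = trans (length-++ s) (+-comm p 1)
    |v| : length (s ++ s ++ [ a ]) ≡ suc (p + p)
    |v| = trans (length-++ s) (trans (cong (p +_) |s++[a]|) (+-suc p p))
    period : Periodic (s ++ s ++ [ a ]) p
    period i i+p<v with m≤n⇒m<n∨m≡n (+-cancelʳ-≤ p i p (≤-pred (subst (i + p <_) |v| i+p<v)))
    ... | inj₁ i<p = begin
      (s ++ s ++ [ a ]) ‼ i        ≡⟨ ++-‼ˡ s _ i<p ⟩
      s ‼ i                        ≡⟨ ++-‼ˡ s [ a ] i<p ⟨
      (s ++ [ a ]) ‼ i             ≡⟨ ++-‼ʳ s _ i ⟨
      (s ++ s ++ [ a ]) ‼ (p + i)  ≡⟨ cong ((s ++ s ++ [ a ]) ‼_) (+-comm p i) ⟩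
      (s ++ s ++ [ a ]) ‼ (i + p)  ∎
      where open ≡-Reasoning
    ... | inj₂ refl = begin
      (s ++ s ++ [ a ]) ‼ p        ≡⟨ cong ((s ++ s ++ [ a ]) ‼_) (+-identityʳ p) ⟨
      (s ++ s ++ [ a ]) ‼ (p + 0)  ≡⟨ ++-‼ʳ s _ 0 ⟩
      just a                       ≡⟨ ++-‼ʳ s [ a ] 0 ⟨
      (s ++ [ a ]) ‼ (p + 0)       ≡⟨ cong ((s ++ [ a ]) ‼_) (+-identityʳ p) ⟩
      (s ++ [ a ]) ‼ p             ≡⟨ ++-‼ʳ s _ p ⟨
      (s ++ s ++ [ a ]) ‼ (p + p)  ∎
      where open ≡-Reasoning

-- Conversely, a word of length 2p + 1 with period p ≥ 1 is an overlap:
-- it is s s c for s its prefix of length p and c = s[0].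
periodic⇒overlap : ∀ {v p} → 1 ≤ p → length v ≡ suc (p + p) → Periodic v p → IsOverlap v
periodic⇒overlap {c ∷ v'} {suc p'} _ |v| period = c , take p' v' , ‼-ext _ _ (trans |v| (sym |ssc|)) letter
  where
    p = suc p'
    v = c ∷ v'
    s = take p v
    |s| : length s ≡ p
    |s| = trans (length-take p v) (m≤n⇒m⊓n≡m (subst (p ≤_) (sym |v|) (≤-trans (m≤m+n p p) (n≤1+n _))))
    |ssc| : length (s ++ s ++ [ c ]) ≡ suc (p + p)
    |ssc| = trans (length-++ s) (trans (cong₂ _+_ |s| (trans (length-++ s) (trans (cong (_+ 1) |s|) (+-comm p 1)))) (+-suc p p))
    -- the second copy of s, then c = v[0] = v[p] = v[2p]
    second : ∀ j → j < p → v ‼ (p + j) ≡ (s ++ s ++ [ c ]) ‼ (p + j)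
    second j j<p = begin
      v ‼ (p + j)                   ≡⟨ cong (v ‼_) (+-comm p j) ⟩
      v ‼ (j + p)                   ≡⟨ period j j+p<v ⟨
      v ‼ j                         ≡⟨ take-‼ p v j<p ⟨
      s ‼ j                         ≡⟨ ++-‼ˡ s [ c ] (subst (j <_) (sym |s|) j<p) ⟨
      (s ++ [ c ]) ‼ j              ≡⟨ ++-‼-past s _ |s| j ⟨
      (s ++ s ++ [ c ]) ‼ (p + j)   ∎
      where
        open ≡-Reasoning
        j+p<v : j + p < length v
        j+p<v = subst (j + p <_) (sym |v|) (s≤s (+-monoˡ-≤ p (<⇒≤ j<p)))
    final : v ‼ (p + p) ≡ (s ++ s ++ [ c ]) ‼ (p + p)
    final = begin
      v ‼ (p + p)                   ≡⟨ period p (subst (p + p <_) (sym |v|) ≤-refl) ⟨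
      v ‼ p                         ≡⟨ period 0 (subst (p <_) (sym |v|) (s≤s (m≤m+n p p))) ⟨
      just c                        ≡⟨ ++-‼-past s [ c ] |s| 0 ⟨
      (s ++ [ c ]) ‼ (p + 0)        ≡⟨ cong ((s ++ [ c ]) ‼_) (+-identityʳ p) ⟩
      (s ++ [ c ]) ‼ p              ≡⟨ ++-‼-past s _ |s| p ⟨
      (s ++ s ++ [ c ]) ‼ (p + p)   ∎
      where open ≡-Reasoning
    letter : ∀ i → i < length v → v ‼ i ≡ (s ++ s ++ [ c ]) ‼ i
    letter i i<v with i <? p
    ... | yes i<p = trans (sym (take-‼ p v i<p)) (sym (++-‼ˡ s _ (subst (i <_) (sym |s|) i<p)))
    ... | no i≮p with m≤n⇒∃[o]m+o≡n (≮⇒≥ i≮p)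
    ... | j , refl with j <? p
    ...   | yes j<p = second j j<p
    ...   | no j≮p rewrite ≤-antisym (+-cancelˡ-≤ p j p (≤-pred (subst (p + j <_) |v| i<v))) (≮⇒≥ j≮p) = final

factor-periodicOn : ∀ u v t {p} → Periodic v p → PeriodicOn (u ++ v ++ t) p (length u) (length u + length v)
factor-periodicOn u v t {p} period k |u|≤k k+p<end with m≤n⇒∃[o]m+o≡n |u|≤k
... | j , refl = begin
  (u ++ v ++ t) ‼ (length u + j)        ≡⟨ ++-‼ʳ u _ j ⟩
  (v ++ t) ‼ j                          ≡⟨ ++-‼ˡ v t (≤-<-trans (m≤m+n j p) j+p<v) ⟩
  v ‼ j                                 ≡⟨ period j j+p<v ⟩
  v ‼ (j + p)                           ≡⟨ ++-‼ˡ v t j+p<v ⟨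
  (v ++ t) ‼ (j + p)                    ≡⟨ ++-‼ʳ u _ (j + p) ⟨
  (u ++ v ++ t) ‼ (length u + (j + p))  ≡⟨ cong ((u ++ v ++ t) ‼_) (+-assoc (length u) j p) ⟨
  (u ++ v ++ t) ‼ (length u + j + p)    ∎
  where
    open ≡-Reasoning
    j+p<v : j + p < length v
    j+p<v = +-cancelˡ-< (length u) (j + p) (length v) (subst (_< length u + length v) (+-assoc (length u) j p) k+p<end)

window-periodic : ∀ w i n {p} → PeriodicOn w p i (i + n) → Periodic (take n (drop i w)) p
window-periodic w i n {p} periodic j j+p<v = begin
  take n (drop i w) ‼ j        ≡⟨ take-‼ n _ (≤-<-trans (m≤m+n j p) j+p<n) ⟩
  drop i w ‼ j                 ≡⟨ drop-‼ i w j ⟩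
  w ‼ (i + j)                  ≡⟨ periodic (i + j) (m≤m+n i j) (subst (_< i + n) (sym (+-assoc i j p)) (+-monoʳ-< i j+p<n)) ⟩
  w ‼ (i + j + p)              ≡⟨ cong (w ‼_) (+-assoc i j p) ⟩
  w ‼ (i + (j + p))            ≡⟨ drop-‼ i w (j + p) ⟨
  drop i w ‼ (j + p)           ≡⟨ take-‼ n _ j+p<n ⟨
  take n (drop i w) ‼ (j + p)  ∎
  where
    open ≡-Reasoning
    j+p<n : j + p < n
    j+p<n = <-≤-trans j+p<v (subst (_≤ n) (sym (length-take n (drop i w))) (m⊓n≤m n _))

overlapFree⇔ix : ∀ w → OverlapFree w ⇔ OverlapFreeIx w
overlapFree⇔ix w = mk⇔ to from
  where
    to : OverlapFree w → OverlapFreeIx w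
    to free i p 1≤p end≤w periodic = free (take i w , v , drop n (drop i w) , split , isOverlap)
      where
        n = suc (p + p)
        v = take n (drop i w)
        split : w ≡ take i w ++ v ++ drop n (drop i w)
        split = sym (trans (cong (take i w ++_) (take++drop≡id n (drop i w))) (take++drop≡id i w))
        |v| : length v ≡ n
        |v| = trans (length-take n (drop i w))
                (m≤n⇒m⊓n≡m (subst (n ≤_) (sym (length-drop i w)) (m+n≤o⇒m≤o∸n n (subst (_≤ length w) (+-comm i n) end≤w))))
        isOverlap : IsOverlap v
        isOverlap = periodic⇒overlap 1≤p |v| (window-periodic w i n periodic)
    from : OverlapFreeIx w → OverlapFree w
    from free (u , v , t , refl , isOverlap) with overlap⇒periodic isOverlap
    ... | p , 1≤p , |v| , period =
      free (length u) p 1≤p end≤w (subst (PeriodicOn w p (length u)) (cong (length u +_) |v|) (factor-periodicOn u v t period))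
      where
        end≤w : length u + suc (p + p) ≤ length w
        end≤w = subst₂ _≤_ (cong (length u +_) |v|) (sym (trans (length-++ u) (cong (length u +_) (length-++ v))))
                  (+-monoʳ-≤ (length u) (m≤m+n (length v) (length t)))

factor-overlapFree : ∀ u v t → OverlapFree (u ++ v ++ t) → OverlapFree v
factor-overlapFree u v t free (u' , v' , t' , refl , isOverlap) =
  free (u ++ u' , v' , t' ++ t , split , isOverlap)
  where
    split : u ++ (u' ++ v' ++ t') ++ t ≡ (u ++ u') ++ v' ++ t' ++ t
    split = begin
      u ++ (u' ++ v' ++ t') ++ t   ≡⟨ cong (u ++_) (++-assoc u' (v' ++ t') t) ⟩
      u ++ u' ++ (v' ++ t') ++ t   ≡⟨ cong (λ r → u ++ u' ++ r) (++-assoc v' t' t) ⟩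
      u ++ u' ++ v' ++ t' ++ t     ≡⟨ ++-assoc u u' _ ⟨
      (u ++ u') ++ v' ++ t' ++ t   ∎
      where open ≡-Reasoning

Cube : Word → ℕ → Set
Cube z c = z ‼ c ≡ z ‼ suc c × z ‼ suc c ≡ z ‼ suc (suc c)

-- A cube is an overlap of period 1.
cube-not-overlapFree : ∀ z c → OverlapFreeIx z → suc (suc c) < length z → ¬ Cube z c
cube-not-overlapFree z c free c+2<z (e₁ , e₂) = free c 1 ≤-refl (subst (_≤ length z) (+-comm 3 c) c+2<z) periodic
  where
    periodic : PeriodicOn z 1 c (c + 3)
    periodic k c≤k k+1<c+3 with m≤n⇒∃[o]m+o≡n c≤k
    ... | 0 , refl = relabel z {c} {j = suc c} (solve (c ∷ [])) (solve (c ∷ [])) e₁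
    ... | 1 , refl = relabel z {suc c} {j = suc (suc c)} (solve (c ∷ [])) (solve (c ∷ [])) e₂
    ... | suc (suc j) , refl = ⊥-elim (<⇒≱ k+1<c+3 (≤-by j (solve (c ∷ j ∷ []))))

guarded-∀? : ∀ {G Q : ℕ → Set} n → (∀ {i} → G i → i < n) → (∀ i → Dec (G i)) → (∀ i → Dec (Q i))
           → Dec (∀ i → G i → Q i)
guarded-∀? n bound G? Q? = map′ (λ all i g → all (bound g) g) (λ all {i} _ g → all i g) (allUpTo? (λ i → G? i →-dec Q? i) n)

-- Decision procedures for the notions above; every quantifier is bounded by a length,
-- so concrete words are checked by evaluation.
infix 4 _≟ₗ_
_≟ₗ_ : (x y : Maybe Bool) → Dec (x ≡ y)
_≟ₗ_ = ≡-dec _≟ᵇ_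

periodic? : ∀ w p → Dec (Periodic w p)
periodic? w p = guarded-∀? (length w) (≤-<-trans (m≤m+n _ p)) (λ i → i + p <? length w) (λ i → w ‼ i ≟ₗ w ‼ (i + p))

periodicOn? : ∀ w p lo hi → Dec (PeriodicOn w p lo hi)
periodicOn? w p lo hi = map′ (λ all k lo≤k k+p<hi → all k k+p<hi lo≤k) (λ all k k+p<hi lo≤k → all k lo≤k k+p<hi)
  (guarded-∀? hi (≤-<-trans (m≤m+n _ p)) (λ k → k + p <? hi) (λ k → lo ≤? k →-dec w ‼ k ≟ₗ w ‼ (k + p)))

overlapFreeIx? : ∀ w → Dec (OverlapFreeIx w)
overlapFreeIx? w = map′ (λ all i p 1≤p end≤n → all i (i<n {i} {p} end≤n) p end≤n 1≤p)
                         (λ free i _ p end≤n 1≤p → free i p 1≤p end≤n)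
  (guarded-∀? n (λ i<n → i<n) (λ i → i <? n) λ i →
     guarded-∀? n (p<n {i}) (λ p → i + suc (p + p) ≤? n) λ p →
       1 ≤? p →-dec ¬? (periodicOn? w p i (i + suc (p + p))))
  where
    n = length w
    i<n : ∀ {i p} → i + suc (p + p) ≤ n → i < n
    i<n {i} end≤n = <-≤-trans (m<m+n i (s≤s z≤n)) end≤n
    p<n : ∀ {i p} → i + suc (p + p) ≤ n → p < n
    p<n {i} {p} end≤n = <-≤-trans (s≤s (m≤m+n p p)) (≤-trans (m≤n+m _ i) end≤n)

nontrivialPeriod? : ∀ w q → Dec (IsNontrivialPeriod w q)
nontrivialPeriod? w q = ((1 ≤? q) ×-dec (q ≤? length w) ×-dec periodic? w q) ×-dec (q <? length w)

nontrivialPeriods : Word → List ℕ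
nontrivialPeriods w = filter (nontrivialPeriod? w) (upTo (length w))

periods-exact : ∀ w → HasExactlyNontrivialPeriods w (length (nontrivialPeriods w))
periods-exact w = nontrivialPeriods w , Unique.filter⁺ (nontrivialPeriod? w) (Unique.upTo⁺ (length w)) , members , refl
  where
    members : ∀ q → (q ∈ nontrivialPeriods w) ⇔ IsNontrivialPeriod w q
    members q = mk⇔ (λ q∈ → proj₂ (∈-filter⁻ (nontrivialPeriod? w) {xs = upTo (length w)} q∈))
                    (λ np → ∈-filter⁺ (nontrivialPeriod? w) (∈-upTo⁺ (proj₂ np)) np)

μ : Word → Word
μ []      = []
μ (a ∷ w) = a ∷ not a ∷ μ w

compl : Maybe Bool → Maybe Bool
compl = Maybe.map not

compl-involutive : ∀ x → compl (compl x) ≡ x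
compl-involutive nothing  = refl
compl-involutive (just a) = cong just (not-involutive a)

compl-injective : ∀ {x y} → compl x ≡ compl y → x ≡ y
compl-injective {x} {y} e = trans (sym (compl-involutive x)) (trans (cong compl e) (compl-involutive y))

compl-letter : ∀ a → just a ≢ compl (just a)
compl-letter false ()
compl-letter true  ()

μ-length : ∀ w → length (μ w) ≡ 2 * length w
μ-length []      = refl
μ-length (a ∷ w) = trans (cong (suc ∘ suc) (μ-length w)) (sym (*-suc 2 (length w)))

μ-‼-even : ∀ w t → μ w ‼ (2 * t) ≡ w ‼ t
μ-‼-even []      t       = refl
μ-‼-even (a ∷ w) zero    = refl
μ-‼-even (a ∷ w) (suc t) = trans (cong (μ (a ∷ w) ‼_) (*-suc 2 t)) (μ-‼-even w t)

μ-‼-odd : ∀ w t → μ w ‼ suc (2 * t) ≡ compl (w ‼ t)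
μ-‼-odd []      t       = refl
μ-‼-odd (a ∷ w) zero    = refl
μ-‼-odd (a ∷ w) (suc t) = trans (cong (λ k → μ (a ∷ w) ‼ suc k) (*-suc 2 t)) (μ-‼-odd w t)

even-shift-even : ∀ z t r → μ z ‼ (2 * t) ≡ μ z ‼ (2 * t + 2 * r) → z ‼ t ≡ z ‼ (t + r)
even-shift-even z t r e =
  trans (sym (μ-‼-even z t)) (trans e (trans (cong (μ z ‼_) (sym (*-distribˡ-+ 2 t r))) (μ-‼-even z (t + r))))

even-shift-odd : ∀ z t r → μ z ‼ suc (2 * t) ≡ μ z ‼ (suc (2 * t) + 2 * r) → z ‼ t ≡ z ‼ (t + r)
even-shift-odd z t r e = compl-injective
  (trans (sym (μ-‼-odd z t)) (trans e (trans (cong (λ k → μ z ‼ suc k) (sym (*-distribˡ-+ 2 t r))) (μ-‼-odd z (t + r)))))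

odd-shift-even-start : ∀ z t r → μ z ‼ (2 * t) ≡ μ z ‼ (2 * t + suc (2 * r))
  → μ z ‼ suc (2 * t) ≡ μ z ‼ (suc (2 * t) + suc (2 * r)) → z ‼ (t + r) ≡ z ‼ suc (t + r)
odd-shift-even-start z t r e₁ e₂ = begin
  z ‼ (t + r)                     ≡⟨ compl-involutive _ ⟨
  compl (compl (z ‼ (t + r)))     ≡⟨ cong compl (trans (sym (μ-‼-odd z (t + r))) (trans (cong (μ z ‼_) i₁) (trans (sym e₁) (μ-‼-even z t)))) ⟩
  compl (z ‼ t)                   ≡⟨ trans (sym (μ-‼-odd z t)) (trans e₂ (trans (cong (μ z ‼_) i₂) (μ-‼-even z (suc (t + r))))) ⟩
  z ‼ suc (t + r)                 ∎
  where
    open ≡-Reasoning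
    i₁ : suc (2 * (t + r)) ≡ 2 * t + suc (2 * r)
    i₁ = solve (t ∷ r ∷ [])
    i₂ : suc (2 * t) + suc (2 * r) ≡ 2 * suc (t + r)
    i₂ = solve (t ∷ r ∷ [])

odd-shift-odd-start : ∀ z t r → μ z ‼ suc (2 * t) ≡ μ z ‼ (suc (2 * t) + suc (2 * r))
  → μ z ‼ (2 * suc t) ≡ μ z ‼ (2 * suc t + suc (2 * r)) → z ‼ t ≡ z ‼ suc t
odd-shift-odd-start z t r e₁ e₂ = begin
  z ‼ t                           ≡⟨ compl-involutive _ ⟨
  compl (compl (z ‼ t))           ≡⟨ cong compl (trans (sym (μ-‼-odd z t)) (trans e₁ (trans (cong (μ z ‼_) i₁) (μ-‼-even z (suc (t + r)))))) ⟩
  compl (z ‼ suc (t + r))         ≡⟨ trans (sym (μ-‼-odd z (suc (t + r)))) (trans (cong (μ z ‼_) i₂) (trans (sym e₂) (μ-‼-even z (suc t)))) ⟩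
  z ‼ suc t                       ∎
  where
    open ≡-Reasoning
    i₁ : suc (2 * t) + suc (2 * r) ≡ 2 * suc (t + r)
    i₁ = solve (t ∷ r ∷ [])
    i₂ : suc (2 * suc (t + r)) ≡ 2 * suc t + suc (2 * r)
    i₂ = solve (t ∷ r ∷ [])

μ-pair-differs : ∀ z t → t < length z → μ z ‼ (2 * t) ≢ μ z ‼ (2 * t + 1)
μ-pair-differs z t t<z e with ‼-defined z t<z
... | a , z[t]≡a = compl-letter a (begin
  just a                 ≡⟨ trans (sym z[t]≡a) (sym (μ-‼-even z t)) ⟩
  μ z ‼ (2 * t)          ≡⟨ e ⟩
  μ z ‼ (2 * t + 1)      ≡⟨ cong (μ z ‼_) (+-comm (2 * t) 1) ⟩
  μ z ‼ suc (2 * t)      ≡⟨ trans (μ-‼-odd z t) (cong compl z[t]≡a) ⟩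
  compl (just a)         ∎)
  where open ≡-Reasoning

odd-period-even-start : ∀ z s r → PeriodicOn (μ z) (suc (2 * r)) (2 * s) (2 * s + (suc (2 * r) + 4)) → Cube z (s + r)
odd-period-even-start z s r periodic =
    odd-shift-even-start z s r (periodic (2 * s) ≤-refl (≤-by 3 (solve (s ∷ r ∷ []))))
                               (periodic (suc (2 * s)) (n≤1+n _) (≤-by 2 (solve (s ∷ r ∷ []))))
  , odd-shift-even-start z (suc s) r (periodic (2 * suc s) (≤-by 2 (solve (s ∷ []))) (≤-by 1 (solve (s ∷ r ∷ []))))
                                     (periodic (suc (2 * suc s)) (≤-by 3 (solve (s ∷ []))) (≤-by 0 (solve (s ∷ r ∷ []))))

odd-period-odd-start : ∀ z s r → PeriodicOn (μ z) (suc (2 * r)) (suc (2 * s)) (suc (2 * s) + (suc (2 * r) + 4)) → Cube z s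
odd-period-odd-start z s r periodic =
    odd-shift-odd-start z s r (periodic (suc (2 * s)) ≤-refl (≤-by 3 (solve (s ∷ r ∷ []))))
                              (periodic (2 * suc s) (≤-by 1 (solve (s ∷ []))) (≤-by 2 (solve (s ∷ r ∷ []))))
  , odd-shift-odd-start z (suc s) r (periodic (suc (2 * suc s)) (≤-by 2 (solve (s ∷ []))) (≤-by 1 (solve (s ∷ r ∷ []))))
                                    (periodic (2 * suc (suc s)) (≤-by 3 (solve (s ∷ []))) (≤-by 0 (solve (s ∷ r ∷ []))))

halve-even-start : ∀ z s r → PeriodicOn (μ z) (2 * r) (2 * s) (2 * s + suc (2 * r + 2 * r))
  → PeriodicOn z r s (s + suc (r + r))
halve-even-start z s r periodic k s≤k k+r<end = even-shift-even z k r (periodic (2 * k) (*-monoʳ-≤ 2 s≤k) bound)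
  where
    open ≤-Reasoning
    bound : 2 * k + 2 * r < 2 * s + suc (2 * r + 2 * r)
    bound = begin
      suc (2 * k + 2 * r)          ≡⟨ solve (k ∷ r ∷ []) ⟩
      suc (2 * (k + r))            ≤⟨ s≤s (*-monoʳ-≤ 2 (≤-pred (subst (k + r <_) (+-suc s (r + r)) k+r<end))) ⟩
      suc (2 * (s + (r + r)))      ≡⟨ solve (s ∷ r ∷ []) ⟩
      2 * s + suc (2 * r + 2 * r)  ∎

halve-odd-start : ∀ z s r → PeriodicOn (μ z) (2 * r) (suc (2 * s)) (suc (2 * s) + suc (2 * r + 2 * r))
  → PeriodicOn z r s (s + suc (r + r))
halve-odd-start z s r periodic k s≤k k+r<end = even-shift-odd z k r (periodic (suc (2 * k)) (s≤s (*-monoʳ-≤ 2 s≤k)) bound)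
  where
    open ≤-Reasoning
    bound : suc (2 * k) + 2 * r < suc (2 * s) + suc (2 * r + 2 * r)
    bound = begin
      suc (suc (2 * k) + 2 * r)           ≡⟨ solve (k ∷ r ∷ []) ⟩
      suc (suc (2 * (k + r)))             ≤⟨ s≤s (s≤s (*-monoʳ-≤ 2 (≤-pred (subst (k + r <_) (+-suc s (r + r)) k+r<end)))) ⟩
      suc (suc (2 * (s + (r + r))))       ≡⟨ solve (s ∷ r ∷ []) ⟩
      suc (2 * s) + suc (2 * r + 2 * r)   ∎

thue : ∀ z → OverlapFreeIx z → OverlapFreeIx (μ z)
thue z free i p 1≤p end≤ = no-overlap (parity i) (parity p) 1≤p (subst (i + suc (p + p) ≤_) (μ-length z) end≤)
  where
    n = length z
    reach : ∀ a {b} → b ≤ 2 * n → suc (2 * a) ≤ b → a < n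
    reach a b≤2n 2a<b = *-cancelˡ-< 2 a n (≤-trans 2a<b b≤2n)

    no-overlap : ∀ {i p} → Parity i → Parity p → 1 ≤ p → i + suc (p + p) ≤ 2 * n
               → ¬ PeriodicOn (μ z) p i (i + suc (p + p))
    -- an even period 2r halves to an overlap of period r in z
    no-overlap (even s) (even (suc r)) _ end≤ periodic =
      free s (suc r) (s≤s z≤n)
        (subst (_≤ n) (sym (+-suc s _)) (reach (s + (suc r + suc r)) end≤ (≤-by 0 (solve (s ∷ r ∷ [])))))
        (halve-even-start z s (suc r) periodic)
    no-overlap (odd s) (even (suc r)) _ end≤ periodic =
      free s (suc r) (s≤s z≤n)
        (subst (_≤ n) (sym (+-suc s _)) (reach (s + (suc r + suc r)) end≤ (≤-by 1 (solve (s ∷ r ∷ [])))))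
        (halve-odd-start z s (suc r) periodic)
    -- the period 1 would equate the two letters μ produces from one letter of z
    no-overlap (even s) (odd 0) _ end≤ periodic =
      μ-pair-differs z s (reach s end≤ (≤-by 2 (solve (s ∷ [])))) (periodic (2 * s) ≤-refl (≤-by 1 (solve (s ∷ []))))
    no-overlap (odd s) (odd 0) _ end≤ periodic =
      μ-pair-differs z (suc s) (reach (suc s) end≤ (≤-by 1 (solve (s ∷ []))))
        (periodic (2 * suc s) (≤-by 1 (solve (s ∷ []))) (≤-by 0 (solve (s ∷ []))))
    -- an odd period 2r + 1 ≥ 3 produces a cube in z
    no-overlap (even s) (odd (suc r)) _ end≤ periodic =
      cube-not-overlapFree z (s + suc r) free (reach (suc (suc (s + suc r))) end≤ (≤-by (2 * r) (solve (s ∷ r ∷ []))))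
        (odd-period-even-start z s (suc r)
          (periodicOn-⊆ (μ z) _ (2 * s + (suc (2 * suc r) + 4)) periodic ≤-refl (≤-by (2 * r) (solve (s ∷ r ∷ [])))))
    no-overlap (odd s) (odd (suc r)) _ end≤ periodic =
      cube-not-overlapFree z s free (reach (suc (suc s)) end≤ (≤-by (4 * r + 3) (solve (s ∷ r ∷ []))))
        (odd-period-odd-start z s (suc r)
          (periodicOn-⊆ (μ z) _ (suc (2 * s) + (suc (2 * suc r) + 4)) periodic ≤-refl (≤-by (2 * r) (solve (s ∷ r ∷ [])))))

μ-periodic : ∀ w p → Periodic w p → Periodic (μ w) (2 * p)
μ-periodic w p periodic k = at (parity k)
  where
    halve : ∀ t → 2 * t + 2 * p < length (μ w) → t + p < length w
    halve t bound = *-cancelˡ-< 2 (t + p) (length w) (subst₂ _<_ (sym (*-distribˡ-+ 2 t p)) (μ-length w) bound)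
    at : ∀ {k} → Parity k → k + 2 * p < length (μ w) → μ w ‼ k ≡ μ w ‼ (k + 2 * p)
    at (even t) bound = begin
      μ w ‼ (2 * t)              ≡⟨ μ-‼-even w t ⟩
      w ‼ t                      ≡⟨ periodic t (halve t bound) ⟩
      w ‼ (t + p)                ≡⟨ μ-‼-even w (t + p) ⟨
      μ w ‼ (2 * (t + p))        ≡⟨ cong (μ w ‼_) (*-distribˡ-+ 2 t p) ⟩
      μ w ‼ (2 * t + 2 * p)      ∎
      where open ≡-Reasoning
    at (odd t) bound = begin
      μ w ‼ suc (2 * t)          ≡⟨ μ-‼-odd w t ⟩
      compl (w ‼ t)              ≡⟨ cong compl (periodic t (halve t (≤-trans (n≤1+n _) bound))) ⟩
      compl (w ‼ (t + p))        ≡⟨ μ-‼-odd w (t + p) ⟨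
      μ w ‼ suc (2 * (t + p))    ≡⟨ cong (λ i → μ w ‼ suc i) (*-distribˡ-+ 2 t p) ⟩
      μ w ‼ (suc (2 * t) + 2 * p) ∎
      where open ≡-Reasoning

trim : Word → Word
trim w = take (length w ∸ 2) (drop 1 w)

trim-length : ∀ w n → length w ≡ 2 + n → length (trim w) ≡ n
trim-length w n ℓ = trans (length-take (length w ∸ 2) (drop 1 w))
  (trans (cong₂ _⊓_ (cong (_∸ 2) ℓ) (trans (length-drop 1 w) (cong (_∸ 1) ℓ))) (m≤n⇒m⊓n≡m (n≤1+n n)))

trim-‼ : ∀ w n {i} → length w ≡ 2 + n → i < n → trim w ‼ i ≡ w ‼ suc i
trim-‼ w n {i} ℓ i<n = trans (take-‼ (length w ∸ 2) (drop 1 w) (subst (i <_) (sym (cong (_∸ 2) ℓ)) i<n)) (drop-‼ 1 w i)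

-- Trimming takes a factor, so it keeps periods and overlap-freeness.
trim-periodic : ∀ w n p → length w ≡ 2 + n → Periodic w p → Periodic (trim w) p
trim-periodic w n p ℓ periodic i i+p<n' = begin
  trim w ‼ i             ≡⟨ trim-‼ w n ℓ (≤-<-trans (m≤m+n i p) i+p<n) ⟩
  w ‼ suc i              ≡⟨ periodic (suc i) (subst (suc i + p <_) (sym ℓ) (s≤s (s≤s (<⇒≤ i+p<n)))) ⟩
  w ‼ suc (i + p)        ≡⟨ trim-‼ w n ℓ i+p<n ⟨
  trim w ‼ (i + p)       ∎
  where
    open ≡-Reasoning
    i+p<n : i + p < n
    i+p<n = subst (i + p <_) (trim-length w n ℓ) i+p<n'

trim-overlapFree : ∀ w → OverlapFree w → OverlapFree (trim w)
trim-overlapFree w free = factor-overlapFree (take 1 w) (trim w) (drop (length w ∸ 2) (drop 1 w)) (subst OverlapFree split free)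
  where
    split : w ≡ take 1 w ++ trim w ++ drop (length w ∸ 2) (drop 1 w)
    split = sym (trans (cong (take 1 w ++_) (take++drop≡id (length w ∸ 2) (drop 1 w))) (take++drop≡id 1 w))

trim-periodicOn : ∀ w n q → length w ≡ 2 + n → Periodic (trim w) q → PeriodicOn w q 1 (suc n)
trim-periodicOn w n q ℓ periodic (suc k) _ (s≤s k+q<n) = begin
  w ‼ suc k              ≡⟨ trim-‼ w n ℓ (≤-<-trans (m≤m+n k q) k+q<n) ⟨
  trim w ‼ k             ≡⟨ periodic k (subst (k + q <_) (sym (trim-length w n ℓ)) k+q<n) ⟩
  trim w ‼ (k + q)       ≡⟨ trim-‼ w n ℓ k+q<n ⟩
  w ‼ suc (k + q)        ∎
  where open ≡-Reasoning

-- If z is overlap-free, a period q of μ z on the window [1, q + 5) is even: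
-- an odd period would produce a cube at the start of z.
period-even : ∀ z q → OverlapFreeIx z → q + 5 ≤ length (μ z) → PeriodicOn (μ z) q 1 (1 + (q + 4)) → ∃[ r ] (q ≡ 2 * r)
period-even z q free q+5≤μz periodic with parity q
... | even r = r , refl
... | odd r  = ⊥-elim (cube-not-overlapFree z 0 free 2<z (odd-period-odd-start z 0 r periodic))
  where
    2<z : 2 < length z
    2<z = *-cancelˡ-< 2 2 (length z) (begin
      5                 ≤⟨ ≤-by (suc (2 * r)) (solve (r ∷ [])) ⟩
      suc (2 * r) + 5   ≤⟨ q+5≤μz ⟩
      length (μ z)      ≡⟨ μ-length z ⟩
      2 * length z      ∎)
      where open ≤-Reasoning

desubstitute : ∀ z q → OverlapFreeIx z → q + 5 ≤ length (μ z) → Periodic (μ z) q → ∃[ r ] (q ≡ 2 * r × Periodic z r)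
desubstitute z q free q+5≤μz periodic
  with period-even z q free q+5≤μz (periodicOn-⊆ (μ z) 1 (1 + (q + 4)) (λ k _ → periodic k) z≤n (≤-trans (≤-reflexive (sym (+-suc q 4))) q+5≤μz))
... | r , refl = r , refl , λ t t+r<z → even-shift-even z t r (periodic (2 * t) (bound t t+r<z))
  where
    bound : ∀ t → t + r < length z → 2 * t + 2 * r < length (μ z)
    bound t t+r<z = subst₂ _<_ (*-distribˡ-+ 2 t r) (sym (μ-length z)) (*-monoʳ-< 2 t+r<z)

desubstitute-trimmed : ∀ z q → OverlapFreeIx z → q + 6 ≤ length (μ z) → Periodic (trim (μ z)) q
  → ∃[ r ] (q ≡ 2 * r × Periodic z r)
desubstitute-trimmed [] q free q+6≤0 periodic with ≤-trans (m≤n+m 6 q) q+6≤0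
... | ()
desubstitute-trimmed z@(c ∷ z') q free q+6≤μz periodic
  with period-even z q free (≤-trans (+-monoʳ-≤ q (n≤1+n 5)) q+6≤μz) (periodicOn-⊆ (μ z) 1 (1 + (q + 4)) window ≤-refl (≤-pred end≤))
  where
    window : PeriodicOn (μ z) q 1 (suc (length (μ z')))
    window = trim-periodicOn (μ z) (length (μ z')) q refl periodic
    end≤ : 2 + (q + 4) ≤ length (μ z)
    end≤ = ≤-relabelˡ q+6≤μz (solve (q ∷ []))
... | r , refl = r , refl , halves
  where
    window : PeriodicOn (μ z) (2 * r) 1 (suc (length (μ z')))
    window = trim-periodicOn (μ z) (length (μ z')) (2 * r) refl periodic
    open ≤-Reasoning
    -- position 0 is read at the odd position 1 of μ z, the others at even positions
    halves : Periodic z r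
    halves zero _ = even-shift-odd z 0 r (window 1 ≤-refl (s≤s (begin
      suc (2 * r)           ≤⟨ ≤-by 3 (solve (r ∷ [])) ⟩
      2 * r + 4             ≤⟨ ≤-pred (≤-pred (≤-relabelˡ q+6≤μz (solve (r ∷ [])))) ⟩
      length (μ z')         ∎)))
    halves (suc t) (s≤s t+r<z') = even-shift-even z (suc t) r (window (2 * suc t) (s≤s z≤n) (s≤s (begin
      2 * suc t + 2 * r     ≡⟨ solve (t ∷ r ∷ []) ⟩
      2 * suc (t + r)       ≤⟨ *-monoʳ-≤ 2 t+r<z' ⟩
      2 * length z'         ≡⟨ μ-length z' ⟨
      length (μ z')         ∎)))

μ²-‼₀ : ∀ x t → μ (μ x) ‼ (4 * t) ≡ x ‼ t
μ²-‼₀ x t = trans (‼-cong (μ (μ x)) (4 * t) (2 * (2 * t)) (solve (t ∷ []))) (trans (μ-‼-even (μ x) (2 * t)) (μ-‼-even x t))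

μ²-‼₁ : ∀ x t → μ (μ x) ‼ (4 * t + 1) ≡ compl (x ‼ t)
μ²-‼₁ x t = trans (‼-cong (μ (μ x)) (4 * t + 1) (suc (2 * (2 * t))) (solve (t ∷ [])))
  (trans (μ-‼-odd (μ x) (2 * t)) (cong compl (μ-‼-even x t)))

μ²-‼₂ : ∀ x t → μ (μ x) ‼ (4 * t + 2) ≡ compl (x ‼ t)
μ²-‼₂ x t = trans (‼-cong (μ (μ x)) (4 * t + 2) (2 * suc (2 * t)) (solve (t ∷ [])))
  (trans (μ-‼-even (μ x) (suc (2 * t))) (μ-‼-odd x t))

μ²-‼₃ : ∀ x t → μ (μ x) ‼ (4 * t + 3) ≡ x ‼ t
μ²-‼₃ x t = trans (‼-cong (μ (μ x)) (4 * t + 3) (suc (2 * suc (2 * t))) (solve (t ∷ [])))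
  (trans (μ-‼-odd (μ x) (suc (2 * t))) (trans (cong compl (μ-‼-odd x t)) (compl-involutive (x ‼ t))))

record Framed (x : Word) (a : Bool) (m : ℕ) : Set where
  field
    length≡ : length x ≡ 2 + m
    1≤m     : 1 ≤ m
    at-0    : x ‼ 0 ≡ just a
    at-1    : x ‼ 1 ≡ just a
    at-m    : x ‼ m ≡ just a
    at-m+1  : x ‼ suc m ≡ just a

framed-periods : ∀ {x a m} → Framed x a m → IsNontrivialPeriod x m × IsNontrivialPeriod x (suc m)
framed-periods {x} {a} {m} F = ((1≤m , m≤x , period-m) , m<x) , ((s≤s z≤n , <⇒≤ m+1<x , period-m+1) , m+1<x)
  where
    open Framed F
    m+1<x : suc m < length x
    m+1<x = subst (suc m <_) (sym length≡) ≤-refl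
    m<x : m < length x
    m<x = <-trans (n<1+n m) m+1<x
    m≤x : m ≤ length x
    m≤x = <⇒≤ m<x
    period-m : Periodic x m
    period-m zero          _ = trans at-0 (sym at-m)
    period-m (suc zero)    _ = trans at-1 (sym at-m+1)
    period-m (suc (suc i)) i+m<x = ⊥-elim (<⇒≱ i+m<x (≤-trans (≤-reflexive length≡) (s≤s (s≤s (m≤n+m m i)))))
    period-m+1 : Periodic x (suc m)
    period-m+1 zero    _ = trans at-0 (sym at-m+1)
    period-m+1 (suc i) i+m<x = ⊥-elim (<⇒≱ i+m<x (≤-trans (≤-reflexive length≡) (s≤s (m≤n+m (suc m) i))))

next : Word → Word
next x = trim (μ (μ x))

μ²-length : ∀ x m → length x ≡ 2 + m → length (μ (μ x)) ≡ 2 + (2 + (4 * m + 4))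
μ²-length x m length≡ = begin
  length (μ (μ x))       ≡⟨ μ-length (μ x) ⟩
  2 * length (μ x)       ≡⟨ cong (2 *_) (μ-length x) ⟩
  2 * (2 * length x)     ≡⟨ cong (λ n → 2 * (2 * n)) length≡ ⟩
  2 * (2 * (2 + m))      ≡⟨ solve (m ∷ []) ⟩
  2 + (2 + (4 * m + 4))  ∎
  where open ≡-Reasoning

next-length : ∀ x m → length x ≡ 2 + m → length (next x) ≡ 2 + (4 * m + 4)
next-length x m length≡ = trim-length (μ (μ x)) _ (μ²-length x m length≡)

next-‼ : ∀ x m {i} → length x ≡ 2 + m → i < 2 + (4 * m + 4) → next x ‼ i ≡ μ (μ x) ‼ suc i
next-‼ x m length≡ = trim-‼ (μ (μ x)) _ (μ²-length x m length≡)

next-framed : ∀ {x a m} → Framed x a m → Framed (next x) (not a) (4 * m + 4)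
next-framed {x} {a} {m} F = record
  { length≡ = next-length x m length≡
  ; 1≤m     = ≤-by (4 * m + 3) (solve (m ∷ []))
  ; at-0    = trans (next-‼ x m length≡ (s≤s z≤n)) (trans (μ²-‼₁ x 0) (cong compl at-0))
  ; at-1    = trans (next-‼ x m length≡ (s≤s (s≤s z≤n))) (trans (μ²-‼₂ x 0) (cong compl at-0))
  ; at-m    = trans (next-‼ x m length≡ (≤-by 1 (solve (m ∷ []))))
                (trans (‼-cong (μ (μ x)) _ (4 * suc m + 1) (solve (m ∷ []))) (trans (μ²-‼₁ x (suc m)) (cong compl at-m+1)))
  ; at-m+1  = trans (next-‼ x m length≡ ≤-refl)
                (trans (‼-cong (μ (μ x)) _ (4 * suc m + 2) (solve (m ∷ []))) (trans (μ²-‼₂ x (suc m)) (cong compl at-m+1)))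
  }
  where open Framed F

-- By Thue's theorem twice, next x is overlap-free with x.
next-overlapFree : ∀ x → OverlapFreeIx x → OverlapFreeIx (next x)
next-overlapFree x free = Equivalence.to (overlapFree⇔ix (next x))
  (trim-overlapFree (μ (μ x)) (Equivalence.from (overlapFree⇔ix (μ (μ x))) (thue (μ x) (thue x free))))

next-inner : ∀ {x a m} → Framed x a m → next x ‼ (4 * m + 2) ≡ just a × next x ‼ (4 * m + 3) ≡ just a
next-inner {x} {a} {m} F =
    trans (next-‼ x m length≡ (≤-by 3 (solve (m ∷ []))))
      (trans (‼-cong (μ (μ x)) _ (4 * m + 3) (solve (m ∷ []))) (trans (μ²-‼₃ x m) at-m))
  , trans (next-‼ x m length≡ (≤-by 2 (solve (m ∷ []))))
      (trans (‼-cong (μ (μ x)) _ (4 * suc m) (solve (m ∷ []))) (trans (μ²-‼₀ x (suc m)) at-m+1))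
  where open Framed F

NextPeriod : Word → ℕ → ℕ → Set
NextPeriod x m q = q ≡ suc (4 * m + 4) ⊎ ∃[ p ] (q ≡ 4 * p × IsNontrivialPeriod x p)

next-period-intro : ∀ {x a m} q → Framed x a m → NextPeriod x m q → IsNontrivialPeriod (next x) q
next-period-intro q F (inj₁ refl) = proj₂ (framed-periods (next-framed F))
next-period-intro {x} {a} {m} q F (inj₂ (p , refl , ((1≤p , _ , periodic) , p<x))) =
  ((≤-trans 1≤p (m≤n*m p 4) , <⇒≤ 4p<y , periodic-y) , 4p<y)
  where
    open Framed F
    4p<y : 4 * p < length (next x)
    4p<y = begin-strict
      4 * p                 ≤⟨ *-monoʳ-≤ 4 (≤-pred (subst (p <_) length≡ p<x)) ⟩
      4 * suc m             <⟨ ≤-by 1 (solve (m ∷ [])) ⟩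
      2 + (4 * m + 4)       ≡⟨ next-length x m length≡ ⟨
      length (next x)       ∎
      where open ≤-Reasoning
    4p≡ : 2 * (2 * p) ≡ 4 * p
    4p≡ = solve (p ∷ [])
    periodic-y : Periodic (next x) (4 * p)
    periodic-y = subst (Periodic (next x)) 4p≡
      (trim-periodic (μ (μ x)) _ _ (μ²-length x m length≡) (μ-periodic (μ x) _ (μ-periodic x p periodic)))

next-period-fresh : ∀ {x a m} → Framed x a m → ∀ p → IsNontrivialPeriod x p → 4 * p ≢ suc (4 * m + 4)
next-period-fresh {x} {a} {m} F p (_ , p<x) = <⇒≢ (begin-strict
  4 * p             ≤⟨ *-monoʳ-≤ 4 (≤-pred (subst (p <_) (Framed.length≡ F) p<x)) ⟩
  4 * suc m         ≡⟨ solve (m ∷ []) ⟩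
  4 * m + 4         <⟨ ≤-refl ⟩
  suc (4 * m + 4)   ∎)
  where open ≤-Reasoning

-- A nontrivial period of next x at distance at least 7 from |next x| is, by two
-- desubstitutions (first through μ (μ x), then through μ x), four times a nontrivial period of x.
next-period-desubstitute : ∀ x m q → OverlapFreeIx x → length x ≡ 2 + m → 1 ≤ q → q + 7 ≤ 2 + (4 * m + 4)
  → Periodic (next x) q → ∃[ s ] (q ≡ 4 * s × IsNontrivialPeriod x s)
next-period-desubstitute x m q free length≡ 1≤q q+7≤y periodic
  with desubstitute-trimmed (μ x) q (thue x free) q+6≤μ²x periodic
  where
    q+6≤μ²x : q + 6 ≤ length (μ (μ x))
    q+6≤μ²x = begin
      q + 6                   ≤⟨ ≤-by 3 (solve (q ∷ [])) ⟩
      q + 7 + 2               ≤⟨ +-monoˡ-≤ 2 q+7≤y ⟩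
      2 + (4 * m + 4) + 2     ≡⟨ solve (m ∷ []) ⟩
      2 + (2 + (4 * m + 4))   ≡⟨ μ²-length x m length≡ ⟨
      length (μ (μ x))        ∎
      where open ≤-Reasoning
... | r , refl , periodic-μx with desubstitute x r free r+5≤μx periodic-μx
  where
    r<2m : r < 2 * m
    r<2m = *-cancelˡ-< 2 r (2 * m) (+-cancelʳ-≤ 6 (suc (2 * r)) (2 * (2 * m)) (begin
      suc (2 * r) + 6         ≡⟨ solve (r ∷ []) ⟩
      2 * r + 7               ≤⟨ q+7≤y ⟩
      2 + (4 * m + 4)         ≡⟨ solve (m ∷ []) ⟩
      2 * (2 * m) + 6         ∎))
      where open ≤-Reasoning
    r+5≤μx : r + 5 ≤ length (μ x)
    r+5≤μx = begin
      r + 5                   ≡⟨ +-suc r 4 ⟩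
      suc r + 4               ≤⟨ +-monoˡ-≤ 4 r<2m ⟩
      2 * m + 4               ≡⟨ solve (m ∷ []) ⟩
      2 * (2 + m)             ≡⟨ cong (2 *_) length≡ ⟨
      2 * length x            ≡⟨ μ-length x ⟨
      length (μ x)            ∎
      where open ≤-Reasoning
...   | s , refl , periodic-x = s , solve (s ∷ []) , ((positive s 1≤q , <⇒≤ s<x , periodic-x) , s<x)
  where
    s<x : s < length x
    s<x = subst (s <_) (sym length≡) (*-cancelˡ-< 4 s (2 + m) (begin
      suc (4 * s)             ≤⟨ ≤-by 6 (solve (s ∷ [])) ⟩
      2 * (2 * s) + 7         ≤⟨ q+7≤y ⟩
      2 + (4 * m + 4)         ≤⟨ ≤-by 2 (solve (m ∷ [])) ⟩
      4 * (2 + m)             ∎))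
      where open ≤-Reasoning
    positive : ∀ s → 1 ≤ 2 * (2 * s) → 1 ≤ s
    positive zero    ()
    positive (suc s) _ = s≤s z≤n

-- Writing
-- |next x| = q + 1 + d, the gaps d = 0, 1, 5 give |next x| - 1, 4(m + 1) and 4m; for
-- d = 2, 3, 4 the period would join a letter ā at position 0 or 1 to a letter a at
-- position 4m + 2 or 4m + 3; for d ≥ 6 the period desubstitutes.
next-period-elim : ∀ {x a m} q → OverlapFreeIx x → Framed x a m → IsNontrivialPeriod (next x) q → NextPeriod x m q
next-period-elim {x} {a} {m} q free F ((1≤q , _ , periodic) , q<y) with m≤n⇒∃[o]m+o≡n q<y
... | d , gap = by-gap d (trans gap (next-length x m length≡))
  where
    open Framed F
    open Framed (next-framed F) using () renaming (at-0 to y[0]≡ā; at-1 to y[1]≡ā)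
    y = next x
    position : ∀ d c → suc q + d ≡ 2 + (4 * m + 4) → suc c + d ≡ 2 + (4 * m + 4) → q ≡ c
    position d c e e' = suc-injective (+-cancelʳ-≡ d (suc q) (suc c) (trans e (sym e')))
    clash : ∀ i j → y ‼ i ≡ just (not a) → y ‼ j ≡ just a → i + q ≡ j → i + q < length y → ⊥
    clash i j y[i]≡ā y[j]≡a refl i+q<y = compl-letter a (trans (sym y[j]≡a) (trans (sym (periodic i i+q<y)) y[i]≡ā))
    by-gap : ∀ d → suc q + d ≡ 2 + (4 * m + 4) → NextPeriod x m q
    by-gap 0 e = inj₁ (position 0 (suc (4 * m + 4)) e (solve (m ∷ [])))
    by-gap 1 e = inj₂ (suc m , position 1 (4 * suc m) e (solve (m ∷ [])) , proj₂ (framed-periods F))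
    by-gap 2 e = ⊥-elim (clash 0 (4 * m + 3) y[0]≡ā (proj₂ (next-inner F)) (position 2 (4 * m + 3) e (solve (m ∷ []))) q<y)
    by-gap 3 e = ⊥-elim (clash 0 (4 * m + 2) y[0]≡ā (proj₁ (next-inner F)) (position 3 (4 * m + 2) e (solve (m ∷ []))) q<y)
    by-gap 4 e = ⊥-elim (clash 1 (4 * m + 2) y[1]≡ā (proj₁ (next-inner F))
                           (trans (cong suc (position 4 (4 * m + 1) e (solve (m ∷ [])))) (solve (m ∷ []))) 1+q<y)
      where
        1+q<y : 1 + q < length y
        1+q<y = begin-strict
          1 + q             <⟨ ≤-by 3 (solve (q ∷ [])) ⟩
          suc q + 4         ≡⟨ e ⟩
          2 + (4 * m + 4)   ≡⟨ next-length x m length≡ ⟨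
          length y          ∎
          where open ≤-Reasoning
    by-gap 5 e = inj₂ (m , position 5 (4 * m) e (solve (m ∷ [])) , proj₁ (framed-periods F))
    by-gap (suc (suc (suc (suc (suc (suc d)))))) e =
      inj₂ (next-period-desubstitute x m q free length≡ 1≤q q+7≤y periodic)
      where
        q+7≤y : q + 7 ≤ 2 + (4 * m + 4)
        q+7≤y = begin
          q + 7             ≤⟨ ≤-by d (solve (q ∷ d ∷ [])) ⟩
          suc q + (6 + d)   ≡⟨ e ⟩
          2 + (4 * m + 4)   ∎
          where open ≤-Reasoning

count-step : ∀ x y {k} N (f : ℕ → ℕ) → (∀ {p p'} → f p ≡ f p' → p ≡ p') → (∀ p → IsNontrivialPeriod x p → f p ≢ N)
  → (∀ q → IsNontrivialPeriod y q ⇔ (q ≡ N ⊎ ∃[ p ] (q ≡ f p × IsNontrivialPeriod x p)))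
  → HasExactlyNontrivialPeriods x k → HasExactlyNontrivialPeriods y (suc k)
count-step x y N f f-injective f≢N periods-y (ps , unique , members , count) =
  N ∷ map f ps , fresh ∷ Unique.map⁺ f-injective unique , members-y , cong suc (trans (length-map f ps) count)
  where
    fresh : All (N ≢_) (map f ps)
    fresh = All.tabulate λ q∈ → case (∈-map⁻ f q∈)
      where
        case : ∀ {q} → ∃[ p ] (p ∈ ps × q ≡ f p) → N ≢ q
        case (p , p∈ , refl) = f≢N p (Equivalence.to (members p) p∈) ∘ sym
    members-y : ∀ q → (q ∈ N ∷ map f ps) ⇔ IsNontrivialPeriod y q
    members-y q = mk⇔ to from
      where
        to : q ∈ N ∷ map f ps → IsNontrivialPeriod y q
        to (here refl) = Equivalence.from (periods-y q) (inj₁ refl)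
        to (there q∈) with ∈-map⁻ f q∈
        ... | p , p∈ , refl = Equivalence.from (periods-y q) (inj₂ (p , refl , Equivalence.to (members p) p∈))
        from : IsNontrivialPeriod y q → q ∈ N ∷ map f ps
        from np with Equivalence.to (periods-y q) np
        ... | inj₁ refl = here refl
        ... | inj₂ (p , refl , np-x) = there (∈-map⁺ f (Equivalence.from (members p) np-x))

record Stage (k : ℕ) : Set where
  field
    word        : Word
    letter      : Bool
    m           : ℕ
    framed      : Framed word letter m
    overlapFree : OverlapFreeIx word
    periods     : HasExactlyNontrivialPeriods word (3 + k)
    size        : 6 * length word ≡ 17 * 4 ^ suc k + 4

-- The initial word 001001100100, with nontrivial periods 9, 10 and 11.
w₀ : Word
w₀ = false ∷ false ∷ true ∷ false ∷ false ∷ true ∷ true ∷ false ∷ false ∷ true ∷ false ∷ false ∷ []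

stage₀ : Stage 0
stage₀ = record
  { word = w₀ ; letter = false ; m = 10
  ; framed = record { length≡ = refl ; 1≤m = s≤s z≤n ; at-0 = refl ; at-1 = refl ; at-m = refl ; at-m+1 = refl }
  ; overlapFree = from-yes (overlapFreeIx? w₀)
  ; periods = periods-exact w₀
  ; size = refl
  }

-- The length recurrence |next x| = 4|x| - 2 in terms of the bound 17·4^(k+1) + 4.
next-size : ∀ m X → 6 * (2 + m) ≡ 17 * X + 4 → 6 * (2 + (4 * m + 4)) ≡ 17 * (4 * X) + 4
next-size m X size = +-cancelʳ-≡ 12 _ _ (begin
  6 * (2 + (4 * m + 4)) + 12   ≡⟨ solve (m ∷ []) ⟩
  4 * (6 * (2 + m))            ≡⟨ cong (4 *_) size ⟩
  4 * (17 * X + 4)             ≡⟨ solve (X ∷ []) ⟩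
  17 * (4 * X) + 4 + 12        ∎)
  where open ≡-Reasoning

stage-next : ∀ {k} → Stage k → Stage (suc k)
stage-next {k} S = record
  { word = next word ; letter = not letter ; m = 4 * m + 4
  ; framed = next-framed framed
  ; overlapFree = next-overlapFree word overlapFree
  ; periods = count-step word (next word) (suc (4 * m + 4)) (4 *_) (*-cancelˡ-≡ _ _ 4) (next-period-fresh framed) next-periods periods
  ; size = trans (cong (6 *_) (next-length word m length≡))
      (next-size m (4 ^ suc k) (trans (cong (6 *_) (sym length≡)) size))
  }
  where
    open Stage S
    open Framed framed using (length≡)
    next-periods : ∀ q → IsNontrivialPeriod (next word) q ⇔ NextPeriod word m q
    next-periods q = mk⇔ (next-period-elim q overlapFree framed) (next-period-intro q framed)

stage : ∀ k → Stage k
stage zero    = stage₀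
stage (suc k) = stage-next (stage k)

good : ∀ w → OverlapFreeIx w → Good (length (nontrivialPeriods w)) w
good w free = Equivalence.from (overlapFree⇔ix w) free , periods-exact w

shortest₁ : ∀ w → Good 1 w → 2 ≤ length w
shortest₁ w (_ , [] , _ , _ , ())
shortest₁ w (_ , q ∷ _ , _ , members , _) with Equivalence.to (members q) (here refl)
... | (1≤q , _) , q<w = ≤-trans (s≤s 1≤q) q<w

words : ℕ → List Word
words zero    = [ [] ]
words (suc n) = map (false ∷_) (words n) ++ map (true ∷_) (words n)

∈-words : ∀ w → w ∈ words (length w)
∈-words []          = here refl
∈-words (false ∷ w) = ∈-++⁺ˡ (∈-map⁺ (false ∷_) (∈-words w))
∈-words (true ∷ w)  = ∈-++⁺ʳ (map (false ∷_) (words (length w))) (∈-map⁺ (true ∷_) (∈-words w))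

≤1-∈-unique : ∀ (xs : List ℕ) {a b} → length xs ≤ 1 → a ∈ xs → b ∈ xs → a ≡ b
≤1-∈-unique (x ∷ [])     _ (here refl) (here refl) = refl
≤1-∈-unique (x ∷ _ ∷ _) (s≤s ())

two-periods : ∀ w → HasExactlyNontrivialPeriods w 2 → ¬ length (nontrivialPeriods w) ≤ 1
two-periods w (q₁ ∷ q₂ ∷ [] , (q₁≢q₂ All.∷ All.[]) ∷ _ , members , refl) ≤1 =
  q₁≢q₂ (≤1-∈-unique (nontrivialPeriods w) ≤1 (listed q₁ (here refl)) (listed q₂ (there (here refl))))
  where
    listed : ∀ q → q ∈ q₁ ∷ q₂ ∷ [] → q ∈ nontrivialPeriods w
    listed q q∈ = ∈-filter⁺ (nontrivialPeriod? w) (∈-upTo⁺ (proj₂ np)) np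
      where np = Equivalence.to (members q) q∈

Refuted : Word → Set
Refuted w = ¬ OverlapFreeIx w ⊎ length (nontrivialPeriods w) ≤ 1

refuted? : ∀ w → Dec (Refuted w)
refuted? w = ¬? (overlapFreeIx? w) ⊎-dec (length (nontrivialPeriods w) ≤? 1)

-- Every word of length at most 4 is refuted (checked exhaustively by evaluation).
short-words-refuted : ∀ {n} → n < 5 → All Refuted (words n)
short-words-refuted = from-yes (allUpTo? (λ n → All.all? refuted? (words n)) 5)

shortest₂ : ∀ w → Good 2 w → 5 ≤ length w
shortest₂ w (free , exactly) with 5 ≤? length w
... | yes 5≤w = 5≤w
... | no 5≰w with All.lookup (short-words-refuted (≰⇒> 5≰w)) (∈-words w)
...   | inj₁ overlapping = ⊥-elim (overlapping (Equivalence.to (overlapFree⇔ix w) free))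
...   | inj₂ ≤1 = ⊥-elim (two-periods w exactly ≤1)

corollary19 : fIs 1 2 × fIs 2 5
    × (∀ p → 3 ≤ p → ∃[ w ] (Good p w × 6 * length w ≤ 17 * 4 ^ (p ∸ 2) + 4))
corollary19 = ((w₁ , good w₁ (from-yes (overlapFreeIx? w₁)) , refl) , shortest₁)
            , ((w₂ , good w₂ (from-yes (overlapFreeIx? w₂)) , refl) , shortest₂)
            , upper-bound
  where
    -- 00 has the single nontrivial period 1; 00100 has the nontrivial periods 3 and 4.
    w₁ w₂ : Word
    w₁ = false ∷ false ∷ []
    w₂ = false ∷ false ∷ true ∷ false ∷ false ∷ []
    -- stage k of the construction witnesses p = k + 3 with equality in the bound
    upper-bound : ∀ p → 3 ≤ p → ∃[ w ] (Good p w × 6 * length w ≤ 17 * 4 ^ (p ∸ 2) + 4)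
    upper-bound 1 (s≤s ())
    upper-bound 2 (s≤s (s≤s ()))
    upper-bound (suc (suc (suc k))) _ =
      word , (Equivalence.from (overlapFree⇔ix word) overlapFree , periods) , ≤-reflexive size
      where open Stage (stage k)
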